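{- For every instance of the heterogeneous data-center right-sizing problem with time-independent operating cost functions $f_{t,j}=f_j$ satisfying $f_j(0)>0$, the schedule $X^{\mathcal A}$ produced by algorithm $\mathcal A$ (described below) is feasible, i.e. $x^{\mathcal A}_{t,j}\in\{0,1,\dots,m_j\}$ and $\sum_{j=1}^dx^{\mathcal A}_{t,j}z^{\max}_j\ge\lambda_t$ for all $t\in[T]$, $j\in[d]$.
   Context: Notation: $[k]=\{1,\dots,k\}$, $[k]_0=\{0,\dots,k\}$, $(x)^+=\max(x,0)$. Problem: An instance consists of $T\in\mathbb N$ slots, $d\in\mathbb N$ server types, $m_j\in\mathbb N$ servers of type $j$, switching costs $\beta_j>0$, capacities $z^{\max}_j>0$, job volumes $\lambda_t\ge0$, and functions $f_{t,j}$ convex, increasing, non-negative on $[0,z^{\max}_j]$ (value $+\infty$ above $z^{\max}_j$). For $x\in\mathbb N_0$, $z\in[0,1]$: $g_{t,j}(x,z)=xf_{t,j}(\lambda_tz/x)$ if $x>0$, $g_{t,j}(0,z)=\infty$ if $\lambda_tz>0$, $=0$ if $\lambda_tz=0$; $g_t(\vec x)=\min_{z\in\mathcal Z}\sum_jg_{t,j}(x_j,z_j)$ with $\mathcal Z=\{z\in[0,1]^d:\sum_jz_j=1\}$. A schedule $X=(\vec x_1,\dots,\vec x_T)$ has $x_{t,j}\in[m_j]_0$, $\vec x_0=\vec x_{T+1}=\vec0$; feasible if $\sum_jx_{t,j}z^{\max}_j\ge\lambda_t$ for all $t$; $C(X)=\sum_{t=1}^T(g_t(\vec x_t)+\sum_j\beta_j(x_{t,j}-x_{t-1,j})^+)$.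 Truncated instances: $\mathcal I^t$ restricts to slots $1..t$ (final state $\vec0$); $\hat X^t$ (entries $\hat x^t_{u,j}$) is an optimal (minimum-cost feasible) schedule for $\mathcal I^t$. Algorithm $\mathcal A$: $\bar t_j=\lceil\beta_j/f_j(0)\rceil$; initialize $w_{t,j}=0$ for all $t\in\mathbb Z$, and $x^{\mathcal A}_{0,j}=0$. For $t=1,\dots,T$: compute $\hat X^t$; for each $j$ set $x^{\mathcal A}_{t,j}:=x^{\mathcal A}_{t-1,j}-w_{t-\bar t_j,j}$; if $x^{\mathcal A}_{t,j}\le\hat x^t_{t,j}$, set $w_{t,j}:=\hat x^t_{t,j}-x^{\mathcal A}_{t,j}$ and $x^{\mathcal A}_{t,j}:=\hat x^t_{t,j}$. -}

module Defs where

open import Level using (0ℓ)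
open import Data.Nat as ℕ using (ℕ; zero; suc; _∸_)
open import Data.Integer as ℤ using (ℤ; +_; _-_)
open import Data.Fin using (Fin)
open import Data.Bool using (Bool; true; false; if_then_else_)
open import Data.Product using (_×_; _,_; proj₁; proj₂)
open import Relation.Binary.PropositionalEquality using (_≡_)
open import Relation.Nullary using (¬_)

-- An abstract totally-ordered-style additive structure standing in for
-- the real numbers ℝ (with +, 0, ≤).  ℝ is an instance.  Only these
-- operations occur in the feasibility condition Σ_j x_j z^max_j ≥ λ_t.
record OrderedAddMonoid : Set₁ where
  infix  4 _≤_
  infixl 6 _+_
  field
    Carrier   : Set
    _≤_       : Carrier → Carrier → Set
    _+_       : Carrier → Carrier → Carrier
    0#        : Carrier
    ≤-refl    : ∀ {a} → a ≤ a
    ≤-trans   : ∀ {a b c} → a ≤ b → b ≤ c → a ≤ c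
    +-assoc   : ∀ a b c → (a + b) + c ≡ a + (b + c)
    +-comm    : ∀ a b → a + b ≡ b + a
    +-identityˡ : ∀ a → 0# + a ≡ a
    +-mono-≤  : ∀ {a b c e} → a ≤ b → c ≤ e → a + c ≤ b + e

  _<_ : Carrier → Carrier → Set
  a < b = (a ≤ b) × ¬ (b ≤ a)

  -- n · a  (n-fold sum; this is the product x_{t,j} z^max_j with x ∈ ℕ)
  _·_ : ℕ → Carrier → Carrier
  zero  · a = 0#
  suc n · a = a + (n · a)

  Σ : ∀ {d} → (Fin d → Carrier) → Carrier
  Σ {zero}  v = 0#
  Σ {suc d} v = v Fin.zero + Σ (λ j → v (Fin.suc j))

-- Feasibility of a schedule for the truncated instance I^t:
-- xs u j = x_{u,j} for slots u ∈ [t], with x_{u,j} ∈ [m_j]_0 and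
-- Σ_j x_{u,j} z^max_j ≥ λ_u.
module _ (R : OrderedAddMonoid) where
  open OrderedAddMonoid R

  FeasibleUpTo : ∀ {d} (m : Fin d → ℕ) (zmax : Fin d → Carrier)
                 (λs : ℕ → Carrier) (t : ℕ) (xs : ℕ → Fin d → ℕ) → Set
  FeasibleUpTo m zmax λs t xs =
    ∀ u → 1 ℕ.≤ u → u ℕ.≤ t →
      (∀ j → xs u j ℕ.≤ m j) × (λs u ≤ Σ (λ j → xs u j · zmax j))

-- Algorithm A, for one fixed server type j (the algorithm treats the
-- types independently).  Inputs: t̄_j and h t = x̂^t_{t,j}.
-- State after slot t: x^A_{t,j} (an integer, no truncation) and the
-- table w_{u,j} (w u = 0 for all slots u not yet set).
record AState : Set where
  constructor ⟨_,_⟩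
  field
    xA : ℤ
    w  : ℕ → ℤ

-- w_{t - t̄, j}, which is 0 when t - t̄ ≤ 0 (initialization w = 0 on ℤ)
lookupW : (tbar t : ℕ) → (ℕ → ℤ) → ℤ
lookupW tbar t w = if tbar ℕ.<ᵇ t then w (t ∸ tbar) else + 0

update : (ℕ → ℤ) → ℕ → ℤ → (ℕ → ℤ)
update w t v u = if u ℕ.≡ᵇ t then v else w u

stepA : (tbar : ℕ) (h : ℕ → ℕ) (t : ℕ) → AState → AState
stepA tbar h t ⟨ x , w ⟩ =
  let x′ = x - lookupW tbar t w in
  if x′ ℤ.≤ᵇ + h t
    then ⟨ + h t , update w t (+ h t - x′) ⟩
    else ⟨ x′ , w ⟩

runA : (tbar : ℕ) (h : ℕ → ℕ) → ℕ → AState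
runA tbar h zero    = ⟨ + 0 , (λ _ → + 0) ⟩
runA tbar h (suc t) = stepA tbar h (suc t) (runA tbar h t)

-- x^A_{t,j} for the whole instance: tbar j = t̄_j, x̂ t u j = x̂^t_{u,j}
algA : ∀ {d} (tbar : Fin d → ℕ) (x̂ : ℕ → ℕ → Fin d → ℕ) → ℕ → Fin d → ℤ
algA tbar x̂ t j = AState.xA (runA (tbar j) (λ s → x̂ s s j) t)

-- The schedule of A only ever switches a server type j up to the optimal
-- truncated value x̂^t_{t,j}, and otherwise switches servers off; so
-- x^A_{t,j} ≥ x̂^t_{t,j} ≥ 0, which gives the load bound because x̂^t is
-- feasible, and x^A_{t,j} ≤ m_j, since it never exceeds the largest
-- earlier value x̂^s_{s,j} ≤ m_j.  The second point needs that the
-- recorded weights w are non-negative, so that subtracting them never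
-- increases x^A.
module Submission where

open import Defs
open import Data.Nat as ℕ using (ℕ; zero; suc; z≤n; s≤s)
open import Data.Integer as ℤ using (ℤ; +_; ∣_∣; _-_; +≤+)
open import Data.Fin using (Fin)
open import Data.Product using (_×_; _,_; proj₁; proj₂)
open import Data.Bool using (true; false; T)
import Data.Nat.Properties as ℕₚ
import Data.Integer.Properties as ℤₚ
open import Relation.Binary.PropositionalEquality using (subst; sym)

module _ (R : OrderedAddMonoid) where
  open OrderedAddMonoid R

  ·-nonNeg : ∀ n {a} → 0# ≤ a → 0# ≤ n · a
  ·-nonNeg zero        0≤a = ≤-refl
  ·-nonNeg (suc n) {a} 0≤a =
    subst (_≤ a + n · a) (+-identityˡ 0#) (+-mono-≤ 0≤a (·-nonNeg n 0≤a))

  ·-monoˡ-≤ : ∀ {a m n} → 0# ≤ a → m ℕ.≤ n → m · a ≤ n · a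
  ·-monoˡ-≤ {n = n} 0≤a z≤n = ·-nonNeg n 0≤a
  ·-monoˡ-≤ 0≤a (s≤s m≤n)   = +-mono-≤ ≤-refl (·-monoˡ-≤ 0≤a m≤n)

  Σ-mono-≤ : ∀ {d} {u v : Fin d → Carrier} → (∀ j → u j ≤ v j) → Σ u ≤ Σ v
  Σ-mono-≤ {zero}  u≤v = ≤-refl
  Σ-mono-≤ {suc d} u≤v =
    +-mono-≤ (u≤v Fin.zero) (Σ-mono-≤ (λ j → u≤v (Fin.suc j)))

+≤⇒≤∣∣ : ∀ {n i} → + n ℤ.≤ i → n ℕ.≤ ∣ i ∣
+≤⇒≤∣∣ (+≤+ n≤m) = n≤m

NonNegative : (ℕ → ℤ) → Set
NonNegative w = ∀ u → + 0 ℤ.≤ w u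

lookupW-nonNeg : ∀ tbar t {w} → NonNegative w → + 0 ℤ.≤ lookupW tbar t w
lookupW-nonNeg tbar t w≥0 with tbar ℕ.<ᵇ t
... | true  = w≥0 (t ℕ.∸ tbar)
... | false = ℤₚ.≤-refl

update-nonNeg : ∀ {w} t {v} → NonNegative w → + 0 ℤ.≤ v →
                NonNegative (update w t v)
update-nonNeg t w≥0 v≥0 u with u ℕ.≡ᵇ t
... | true  = v≥0
... | false = w≥0 u

BoundedBy : ℕ → AState → Set
BoundedBy M s = NonNegative (AState.w s) × (AState.xA s ℤ.≤ + M)

stepA-≥ : ∀ tbar h t s → + h t ℤ.≤ AState.xA (stepA tbar h t s)
stepA-≥ tbar h t ⟨ x , w ⟩ with x - lookupW tbar t w ℤ.≤ᵇ + h t in eq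
... | true  = ℤₚ.≤-refl
... | false = ℤₚ.<⇒≤ (ℤₚ.≰⇒> λ x′≤h → subst T eq (ℤₚ.≤⇒≤ᵇ x′≤h))

stepA-bounded : ∀ {M} tbar h t {s} → h t ℕ.≤ M →
                BoundedBy M s → BoundedBy M (stepA tbar h t s)
stepA-bounded tbar h t {⟨ x , w ⟩} h≤M (w≥0 , x≤M)
  with x - lookupW tbar t w ℤ.≤ᵇ + h t in eq
... | true  = update-nonNeg t w≥0 (ℤₚ.i≤j⇒0≤j-i x′≤h) , +≤+ h≤M
  where
  x′≤h : x - lookupW tbar t w ℤ.≤ + h t
  x′≤h = ℤₚ.≤ᵇ⇒≤ (subst T (sym eq) _)
... | false = w≥0 , ℤₚ.i≤j⇒i-k≤j _ {{w-nonNeg}} x≤M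
  where
  w-nonNeg : ℤ.NonNegative (lookupW tbar t w)
  w-nonNeg = ℤ.nonNegative (lookupW-nonNeg tbar t w≥0)

runA-bounded : ∀ {M} tbar h t → (∀ s → 1 ℕ.≤ s → s ℕ.≤ t → h s ℕ.≤ M) →
               BoundedBy M (runA tbar h t)
runA-bounded tbar h zero    h≤M = (λ _ → ℤₚ.≤-refl) , +≤+ z≤n
runA-bounded tbar h (suc t) h≤M =
  stepA-bounded tbar h (suc t) (h≤M (suc t) (s≤s z≤n) ℕₚ.≤-refl)
    (runA-bounded tbar h t λ s 1≤s s≤t → h≤M s 1≤s (ℕₚ.m≤n⇒m≤1+n s≤t))

lemma1 : (R : OrderedAddMonoid) →
         let open OrderedAddMonoid R in
         (T d : ℕ) (m : Fin d → ℕ) (zmax : Fin d → Carrier)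
         (λs : ℕ → Carrier) (tbar : Fin d → ℕ) (x̂ : ℕ → ℕ → Fin d → ℕ) →
         (∀ j → 0# < zmax j) →
         (∀ t → 0# ≤ λs t) →
         (∀ j → 1 ℕ.≤ tbar j) →
         (∀ t → 1 ℕ.≤ t → t ℕ.≤ T → FeasibleUpTo R m zmax λs t (x̂ t)) →
         ∀ t → 1 ℕ.≤ t → t ℕ.≤ T →
           (∀ j → (+ 0 ℤ.≤ algA tbar x̂ t j) × (algA tbar x̂ t j ℤ.≤ + m j))
           × (λs t ≤ Σ (λ j → ∣ algA tbar x̂ t j ∣ · zmax j))
lemma1 R T d m zmax λs tbar x̂ zmax>0 _ _ feasible (suc t) 1≤t t≤T =
  (λ j → ℤₚ.≤-trans (+≤+ z≤n) (x̂≤xA j) , xA≤m j) ,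
  ≤-trans (proj₂ (x̂-feasible (suc t) 1≤t t≤T))
          (Σ-mono-≤ R λ j → ·-monoˡ-≤ R (proj₁ (zmax>0 j)) (+≤⇒≤∣∣ (x̂≤xA j)))
  where
  open OrderedAddMonoid R
  x̂-feasible : ∀ s → 1 ℕ.≤ s → s ℕ.≤ T →
               (∀ j → x̂ s s j ℕ.≤ m j) × (λs s ≤ Σ (λ j → x̂ s s j · zmax j))
  x̂-feasible s 1≤s s≤T = feasible s 1≤s s≤T s 1≤s ℕₚ.≤-refl
  x̂≤xA : ∀ j → + x̂ (suc t) (suc t) j ℤ.≤ algA tbar x̂ (suc t) j
  x̂≤xA j = stepA-≥ (tbar j) (λ s → x̂ s s j) (suc t) (runA (tbar j) (λ s → x̂ s s j) t)
  xA≤m : ∀ j → algA tbar x̂ (suc t) j ℤ.≤ + m j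
  xA≤m j = proj₂ (runA-bounded (tbar j) (λ s → x̂ s s j) (suc t) λ s 1≤s s≤t →
             proj₁ (x̂-feasible s 1≤s (ℕₚ.≤-trans s≤t t≤T)) j)
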